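{- Let $R$ be a local ring with maximal ideal $\mathfrak m$ which is complete and separated with respect to its $\mathfrak m$-adic topology, let $\sigma$ be a ring endomorphism of $R$ with $\sigma(\mathfrak m)\subseteq\mathfrak m$, and let $\delta$ be a $\sigma$-derivation of $R$ with $\delta(R)\subseteq\mathfrak m$ and $\delta(\mathfrak m)\subseteq\mathfrak m^2$. Let $A=R[[X;\sigma,\delta]]$. Then an element $f=\sum_i f_iX^i\in A$ is a unit of $A$ if and only if its constant term $f_0$ is a unit of $R$. In particular, $A$ is a local ring.
   Context: A $\sigma$-derivation is an additive map $\delta$ with $\delta(rs)=\delta(r)s+\sigma(r)\delta(s)$. $R[[X;\sigma,\delta]]$ is the ring of formal power series $\sum r_nX^n$, $r_n\in R$, with multiplication determined by $Xr=\sigma(r)X+\delta(r)$. A local ring is a ring whose non-units form a proper (two-sided) ideal. -}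

module Defs where

open import Level using (Level; _⊔_)
open import Data.Nat using (ℕ; zero; suc; _≤_; _∸_)
open import Data.Product using (Σ; _×_)
open import Relation.Nullary using (¬_)
open import Algebra.Bundles using (Ring)
open import Algebra.Morphism.Structures using (IsRingHomomorphism)

-- Multiplication is given as a relation  Mul x y z  ("x·y = z"), so
-- that the same definition applies to R (Mul x y z := x * y ≈ z) and to
-- the skew power series ring, whose product is defined via m-adic limits.

module _ {a r : Level} {C : Set a} (one : C) (Mul : C → C → C → Set r) where

  UnitRel : C → Set (a ⊔ r)
  UnitRel x = Σ C (λ y → Mul x y one × Mul y x one)

record IsLocalRel {a r : Level} {C : Set a} (zro one : C) (_⊕_ : C → C → C)
                  (Mul : C → C → C → Set r) : Set (a ⊔ r) where
  NonUnit : C → Set (a ⊔ r)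
  NonUnit x = ¬ UnitRel one Mul x
  field
    zero-mem  : NonUnit zro
    add-mem   : ∀ x y → NonUnit x → NonUnit y → NonUnit (x ⊕ y)
    left-mem  : ∀ s x z → NonUnit x → Mul s x z → NonUnit z
    right-mem : ∀ x s z → NonUnit x → Mul x s z → NonUnit z
    proper    : ¬ NonUnit one

module _ {c ℓ : Level} (R : Ring c ℓ) where
  open Ring R hiding (zero)

  Unit : Carrier → Set (c ⊔ ℓ)
  Unit = UnitRel 1# (λ x y z → x * y ≈ z)

  NonUnit : Carrier → Set (c ⊔ ℓ)
  NonUnit x = ¬ Unit x

  IsLocal : Set (c ⊔ ℓ)
  IsLocal = IsLocalRel 0# 1# _+_ (λ x y z → x * y ≈ z)

  -- Powers of the ideal m of non-units (m is the maximal ideal of a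
  -- local ring): InPow n x  means  x ∈ m^n, where m^0 = R and
  -- m^(n+1) = m · m^n is the additive subgroup generated by products
  -- a * b with a ∈ m, b ∈ m^n.
  data InPow : ℕ → Carrier → Set (c ⊔ ℓ) where
    pow-zero : ∀ x → InPow zero x
    pow-0#   : ∀ {n x} → x ≈ 0# → InPow (suc n) x
    pow-mul  : ∀ {n a b x} → NonUnit a → InPow n b → x ≈ a * b → InPow (suc n) x
    pow-add  : ∀ {n x y z} → InPow (suc n) x → InPow (suc n) y → z ≈ x + y
             → InPow (suc n) z

  ConvergesTo : (ℕ → Carrier) → Carrier → Set (c ⊔ ℓ)
  ConvergesTo s L = ∀ k → Σ ℕ (λ N → ∀ n → N ≤ n → InPow k (s n - L))

  Cauchy : (ℕ → Carrier) → Set (c ⊔ ℓ)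
  Cauchy s = ∀ k → Σ ℕ (λ N → ∀ n n′ → N ≤ n → N ≤ n′ → InPow k (s n - s n′))

  Complete : Set (c ⊔ ℓ)
  Complete = ∀ s → Cauchy s → Σ Carrier (λ L → ConvergesTo s L)

  Separated : Set (c ⊔ ℓ)
  Separated = ∀ x → (∀ k → InPow k x) → x ≈ 0#

  sumTo : (ℕ → Carrier) → ℕ → Carrier
  sumTo f zero    = 0#
  sumTo f (suc n) = sumTo f n + f n

  SeriesSum : (ℕ → Carrier) → Carrier → Set (c ⊔ ℓ)
  SeriesSum a L = ConvergesTo (sumTo a) L

  record IsSigmaDerivation (σ δ : Carrier → Carrier) : Set (c ⊔ ℓ) where
    field
      cong    : ∀ {x y} → x ≈ y → δ x ≈ δ y
      +-homo  : ∀ x y → δ (x + y) ≈ δ x + δ y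
      leibniz : ∀ x y → δ (x * y) ≈ δ x * y + σ x * δ y

  -- The skew power series ring A = R[[X;σ,δ]].
  -- An element Σ f_n X^n is represented by its coefficient sequence.

  Series : Set c
  Series = ℕ → Carrier

  module Skew (σ δ : Carrier → Carrier) where

    -- X^i r = Σ_k τ i k r X^k   (from X r = σ(r) X + δ(r))
    τ : ℕ → ℕ → Carrier → Carrier
    τ zero    zero    x = x
    τ zero    (suc k) x = 0#
    τ (suc i) zero    x = δ (τ i zero x)
    τ (suc i) (suc k) x = σ (τ i k x) + δ (τ i (suc k) x)

    productTerm : Series → Series → ℕ → ℕ → Carrier
    productTerm f g n i = f i * sumTo (λ j → τ i (n ∸ j) (g j)) (suc n)

    IsProduct : Series → Series → Series → Set (c ⊔ ℓ)
    IsProduct f g h = ∀ n → SeriesSum (productTerm f g n) (h n)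

    zeroA : Series
    zeroA _ = 0#

    oneA : Series
    oneA zero    = 1#
    oneA (suc _) = 0#

    _+A_ : Series → Series → Series
    (f +A g) n = f n + g n

    UnitA : Series → Set (c ⊔ ℓ)
    UnitA = UnitRel oneA IsProduct

    IsLocalA : Set (c ⊔ ℓ)
    IsLocalA = IsLocalRel zeroA oneA _+A_ IsProduct

-- Write m for the ideal of non-units. As σ(m) ⊆ m, δ(R) ⊆ m and δ(m) ⊆ m², the map δ raises
-- m-adic order, so in Xⁱ r = Σₖ τ i k r Xᵏ the coefficient τ i k r lies in m^(i ∸ k). Hence every
-- coefficient of a product in A is an m-adically convergent series, and the product is associative
-- (sum a double series by rows or by columns). The constant term of f g is f₀ g₀ modulo m, and
-- 1 + m consists of units by completeness, so f g = 1 forces f₀ to be a unit. Conversely, if f₀ is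
-- a unit, the coefficients of a right inverse g are found one at a time: the n-th equation reads
-- f₀ gₙ + Ψ gₙ = cₙ with Ψ raising m-adic order, and is solved by a fixed point. Then g₀ is a unit
-- too, g has a right inverse h, and h = f by associativity. So the non-units of A are the series
-- with constant term in m, and they form an ideal because m does.
module Submission where

open import Level using (Level; _⊔_)
open import Data.Product using (_×_; Σ; _,_; proj₁; proj₂)
open import Data.Sum using (_⊎_; inj₁; inj₂)
open import Data.Empty using (⊥-elim)
open import Function.Bundles using (_⇔_; mk⇔)
open import Relation.Nullary using (¬_; yes; no)
open import Relation.Binary.PropositionalEquality as ≡ using (_≡_)
open import Algebra.Bundles using (Ring)
open import Algebra.Morphism.Structures using (IsRingHomomorphism)
open import Data.Nat as ℕ using (ℕ; zero; suc; _≤_; _<_; _∸_; z≤n; s≤s; _≤′_; ≤′-refl; ≤′-step)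
  renaming (_+_ to _+ℕ_; _⊔_ to _⊔ℕ_)
import Data.Nat.Properties as ℕₚ
open import Defs

module RingUnits {c ℓ} (R : Ring c ℓ) where
  open Ring R
  open import Relation.Binary.Reasoning.Setoid setoid

  Unit-intro : ∀ {w x y} → w * x ≈ 1# → y * w ≈ 1# → Unit R w
  Unit-intro {w} {x} {y} wx≈1 yw≈1 = x , wx≈1 , trans (*-congʳ x≈y) yw≈1
    where
    x≈y : x ≈ y
    x≈y = begin
      x             ≈⟨ *-identityˡ x ⟨
      1# * x        ≈⟨ *-congʳ yw≈1 ⟨
      (y * w) * x   ≈⟨ *-assoc y w x ⟩
      y * (w * x)   ≈⟨ *-congˡ wx≈1 ⟩
      y * 1#        ≈⟨ *-identityʳ y ⟩
      y             ∎

  Unit-*-cancelˡ : ∀ {a b} → Unit R a → Unit R (a * b) → Unit R b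
  Unit-*-cancelˡ {a} {b} (a⁻¹ , _ , a⁻¹a≈1) (c , abc≈1 , cab≈1) =
    c * a , bca≈1 , trans (*-assoc c a b) cab≈1
    where
    bca≈1 : b * (c * a) ≈ 1#
    bca≈1 = begin
      b * (c * a)                ≈⟨ *-identityˡ _ ⟨
      1# * (b * (c * a))         ≈⟨ *-congʳ a⁻¹a≈1 ⟨
      (a⁻¹ * a) * (b * (c * a))  ≈⟨ *-assoc a⁻¹ a _ ⟩
      a⁻¹ * (a * (b * (c * a)))  ≈⟨ *-congˡ (*-assoc a b _) ⟨
      a⁻¹ * ((a * b) * (c * a))  ≈⟨ *-congˡ (*-assoc (a * b) c a) ⟨
      a⁻¹ * (((a * b) * c) * a)  ≈⟨ *-congˡ (*-congʳ abc≈1) ⟩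
      a⁻¹ * (1# * a)             ≈⟨ *-congˡ (*-identityˡ a) ⟩
      a⁻¹ * a                    ≈⟨ a⁻¹a≈1 ⟩
      1#                         ∎

module LocalRingFiltration {c ℓ} (R : Ring c ℓ) (local : IsLocal R) where
  open Ring R hiding (zero)
  open import Algebra.Properties.Ring R using (-1*x≈-x)
  open import Algebra.Properties.RingWithoutOne ringWithoutOne
    using (x+x≈x⇒x≈0; x[y-z]≈xy-xz; [y-z]x≈yx-zx)
  open import Algebra.Properties.AbelianGroup +-abelianGroup using (⁻¹-anti-homo‿-; ⁻¹-∙-comm)
  open import Algebra.Properties.Group +-group
    using (ε⁻¹≈ε; inverseʳ-unique; x∙y⁻¹≈ε⇒x≈y; x≈y⇒x∙y⁻¹≈ε; //-rightDividesʳ)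
  open import Algebra.Properties.CommutativeSemigroup +-commutativeSemigroup using (interchange)
  open import Relation.Binary.Reasoning.Setoid setoid
  open IsLocalRel local using (zero-mem; add-mem; left-mem; right-mem)
  open RingUnits R

  NonUnit-resp : ∀ {x y} → NonUnit R x → x ≈ y → NonUnit R y
  NonUnit-resp x∉U x≈y = left-mem 1# _ _ x∉U (trans (*-identityˡ _) x≈y)

  infix 4 _∈m^_
  _∈m^_ : Carrier → ℕ → Set (c ⊔ ℓ)
  x ∈m^ k = InPow R k x

  ∈m^-resp : ∀ {k x y} → x ∈m^ k → x ≈ y → y ∈m^ k
  ∈m^-resp (pow-zero _)         _   = pow-zero _
  ∈m^-resp (pow-0# x≈0)         x≈y = pow-0# (trans (sym x≈y) x≈0)
  ∈m^-resp (pow-mul a∉U b∈ x≈)  x≈y = pow-mul a∉U b∈ (trans (sym x≈y) x≈)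
  ∈m^-resp (pow-add x₁∈ x₂∈ x≈) x≈y = pow-add x₁∈ x₂∈ (trans (sym x≈y) x≈)

  ≈0⇒∈m^ : ∀ k {x} → x ≈ 0# → x ∈m^ k
  ≈0⇒∈m^ zero    _   = pow-zero _
  ≈0⇒∈m^ (suc k) x≈0 = pow-0# x≈0

  ∈m^-+ : ∀ {k x y} → x ∈m^ k → y ∈m^ k → x + y ∈m^ k
  ∈m^-+ {zero}  _   _   = pow-zero _
  ∈m^-+ {suc k} x∈ y∈ = pow-add x∈ y∈ refl

  ∈m^-*ˡ : ∀ {k x} r → x ∈m^ k → r * x ∈m^ k
  ∈m^-*ˡ r (pow-zero x)   = pow-zero _
  ∈m^-*ˡ r (pow-0# x≈0)   = pow-0# (trans (*-congˡ x≈0) (zeroʳ r))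
  ∈m^-*ˡ r (pow-mul {a = a} a∉U b∈ x≈ab) =
    pow-mul (left-mem r a (r * a) a∉U refl) b∈ (trans (*-congˡ x≈ab) (sym (*-assoc r a _)))
  ∈m^-*ˡ r (pow-add x₁∈ x₂∈ x≈) =
    pow-add (∈m^-*ˡ r x₁∈) (∈m^-*ˡ r x₂∈) (trans (*-congˡ x≈) (distribˡ r _ _))

  ∈m^-*ʳ : ∀ {k x} r → x ∈m^ k → x * r ∈m^ k
  ∈m^-*ʳ r (pow-zero x)   = pow-zero _
  ∈m^-*ʳ r (pow-0# x≈0)   = pow-0# (trans (*-congʳ x≈0) (zeroˡ r))
  ∈m^-*ʳ r (pow-mul {a = a} {b = b} a∉U b∈ x≈ab) =
    pow-mul a∉U (∈m^-*ʳ r b∈) (trans (*-congʳ x≈ab) (*-assoc a b r))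
  ∈m^-*ʳ r (pow-add x₁∈ x₂∈ x≈) =
    pow-add (∈m^-*ʳ r x₁∈) (∈m^-*ʳ r x₂∈) (trans (*-congʳ x≈) (distribʳ r _ _))

  ∈m^-* : ∀ {j k x y} → x ∈m^ j → y ∈m^ k → x * y ∈m^ (j +ℕ k)
  ∈m^-* (pow-zero x)   y∈ = ∈m^-*ˡ x y∈
  ∈m^-* (pow-0# x≈0)   y∈ = pow-0# (trans (*-congʳ x≈0) (zeroˡ _))
  ∈m^-* (pow-mul {a = a} {b = b} a∉U b∈ x≈ab) y∈ =
    pow-mul a∉U (∈m^-* b∈ y∈) (trans (*-congʳ x≈ab) (*-assoc a b _))
  ∈m^-* (pow-add x₁∈ x₂∈ x≈) y∈ =
    pow-add (∈m^-* x₁∈ y∈) (∈m^-* x₂∈ y∈) (trans (*-congʳ x≈) (distribʳ _ _ _))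

  ∈m^-neg : ∀ {k x} → x ∈m^ k → - x ∈m^ k
  ∈m^-neg x∈ = ∈m^-resp (∈m^-*ˡ (- 1#) x∈) (-1*x≈-x _)

  ∈m^-pred : ∀ {k x} → x ∈m^ suc k → x ∈m^ k
  ∈m^-pred {zero}  _                   = pow-zero _
  ∈m^-pred {suc k} (pow-0# x≈0)        = pow-0# x≈0
  ∈m^-pred {suc k} (pow-mul a∉U b∈ x≈) = pow-mul a∉U (∈m^-pred b∈) x≈
  ∈m^-pred {suc k} (pow-add x₁∈ x₂∈ x≈) = pow-add (∈m^-pred x₁∈) (∈m^-pred x₂∈) x≈

  ∈m^-antitone′ : ∀ {j k x} → j ≤′ k → x ∈m^ k → x ∈m^ j
  ∈m^-antitone′ ≤′-refl          x∈ = x∈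
  ∈m^-antitone′ (≤′-step j≤′k) x∈ = ∈m^-antitone′ j≤′k (∈m^-pred x∈)

  ∈m^-antitone : ∀ {j k x} → j ≤ k → x ∈m^ k → x ∈m^ j
  ∈m^-antitone j≤k = ∈m^-antitone′ (ℕₚ.≤⇒≤′ j≤k)

  NonUnit⇒∈m¹ : ∀ {x} → NonUnit R x → x ∈m^ 1
  NonUnit⇒∈m¹ x∉U = pow-mul x∉U (pow-zero 1#) (sym (*-identityʳ _))

  ∈m¹⇒NonUnit : ∀ {x} → x ∈m^ 1 → NonUnit R x
  ∈m¹⇒NonUnit (pow-0# x≈0)        = NonUnit-resp zero-mem (sym x≈0)
  ∈m¹⇒NonUnit (pow-mul a∉U _ x≈)  = NonUnit-resp (right-mem _ _ _ a∉U refl) (sym x≈)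
  ∈m¹⇒NonUnit (pow-add x₁∈ x₂∈ x≈) =
    NonUnit-resp (add-mem _ _ (∈m¹⇒NonUnit x₁∈) (∈m¹⇒NonUnit x₂∈)) (sym x≈)

  infix 4 _~[_]_
  _~[_]_ : Carrier → ℕ → Carrier → Set (c ⊔ ℓ)
  x ~[ k ] y = x - y ∈m^ k

  ≈⇒~ : ∀ {k x y} → x ≈ y → x ~[ k ] y
  ≈⇒~ {k} x≈y = ≈0⇒∈m^ k (x≈y⇒x∙y⁻¹≈ε x≈y)

  ~-refl : ∀ {k x} → x ~[ k ] x
  ~-refl = ≈⇒~ refl

  ~-sym : ∀ {k x y} → x ~[ k ] y → y ~[ k ] x
  ~-sym {x = x} {y} x~y = ∈m^-resp (∈m^-neg x~y) (⁻¹-anti-homo‿- x y)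

  [x-y]+[y-z]≈x-z : ∀ x y z → (x - y) + (y - z) ≈ x - z
  [x-y]+[y-z]≈x-z x y z = begin
    (x - y) + (y - z)    ≈⟨ +-assoc x (- y) (y - z) ⟩
    x + (- y + (y - z))  ≈⟨ +-congˡ (+-assoc (- y) y (- z)) ⟨
    x + ((- y + y) - z)  ≈⟨ +-congˡ (+-congʳ (-‿inverseˡ y)) ⟩
    x + (0# - z)         ≈⟨ +-congˡ (+-identityˡ (- z)) ⟩
    x - z                ∎

  ~-trans : ∀ {k x y z} → x ~[ k ] y → y ~[ k ] z → x ~[ k ] z
  ~-trans {x = x} {y} {z} x~y y~z = ∈m^-resp (∈m^-+ x~y y~z) ([x-y]+[y-z]≈x-z x y z)

  ~-resp : ∀ {k x y x′ y′} → x ~[ k ] y → x ≈ x′ → y ≈ y′ → x′ ~[ k ] y′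
  ~-resp x~y x≈x′ y≈y′ = ~-trans (≈⇒~ (sym x≈x′)) (~-trans x~y (≈⇒~ y≈y′))

  ~-+ : ∀ {k x x′ y y′} → x ~[ k ] x′ → y ~[ k ] y′ → x + y ~[ k ] x′ + y′
  ~-+ {x = x} {x′} {y} {y′} x~x′ y~y′ = ∈m^-resp (∈m^-+ x~x′ y~y′) (begin
    (x - x′) + (y - y′)      ≈⟨ interchange x (- x′) y (- y′) ⟩
    (x + y) + (- x′ + - y′)  ≈⟨ +-congˡ (⁻¹-∙-comm x′ y′) ⟩
    (x + y) - (x′ + y′)      ∎)

  ~-*ˡ-∈m^ : ∀ {j k t x y} → t ∈m^ j → x ~[ k ] y → t * x ~[ j +ℕ k ] t * y
  ~-*ˡ-∈m^ {t = t} {x} {y} t∈ x~y = ∈m^-resp (∈m^-* t∈ x~y) (x[y-z]≈xy-xz t x y)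

  ~-*ʳ-∈m^ : ∀ {j k t x y} → t ∈m^ j → x ~[ k ] y → x * t ~[ j +ℕ k ] y * t
  ~-*ʳ-∈m^ {j} {k} {t} {x} {y} t∈ x~y =
    ≡.subst (λ n → x * t ~[ n ] y * t) (ℕₚ.+-comm k j) (∈m^-resp (∈m^-* x~y t∈) ([y-z]x≈yx-zx t x y))

  ~-*ˡ : ∀ {k x y} r → x ~[ k ] y → r * x ~[ k ] r * y
  ~-*ˡ r = ~-*ˡ-∈m^ (pow-zero r)

  x-0≈x : ∀ x → x - 0# ≈ x
  x-0≈x x = trans (+-congˡ ε⁻¹≈ε) (+-identityʳ x)

  ∈m^⇒~0 : ∀ {k x} → x ∈m^ k → x ~[ k ] 0#
  ∈m^⇒~0 x∈ = ∈m^-resp x∈ (sym (x-0≈x _))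

  ~0⇒∈m^ : ∀ {k x} → x ~[ k ] 0# → x ∈m^ k
  ~0⇒∈m^ x~0 = ∈m^-resp x~0 (x-0≈x _)

  ∀<suc⇒∀< : ∀ {p n} {P : ℕ → Set p} → (∀ i → i < suc n → P i) → ∀ i → i < n → P i
  ∀<suc⇒∀< h i i<n = h i (ℕₚ.m<n⇒m<1+n i<n)

  sumTo-cong : ∀ {f g} n → (∀ i → i < n → f i ≈ g i) → sumTo R f n ≈ sumTo R g n
  sumTo-cong zero    f≈g = refl
  sumTo-cong (suc n) f≈g = +-cong (sumTo-cong n (∀<suc⇒∀< f≈g)) (f≈g n (ℕₚ.n<1+n n))

  sumTo-~ : ∀ {k f g} n → (∀ i → i < n → f i ~[ k ] g i) → sumTo R f n ~[ k ] sumTo R g n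
  sumTo-~ zero    f~g = ~-refl
  sumTo-~ (suc n) f~g = ~-+ (sumTo-~ n (∀<suc⇒∀< f~g)) (f~g n (ℕₚ.n<1+n n))

  sumTo-∈m^ : ∀ {k f} n → (∀ i → i < n → f i ∈m^ k) → sumTo R f n ∈m^ k
  sumTo-∈m^ {k} zero    f∈ = ≈0⇒∈m^ k refl
  sumTo-∈m^     (suc n) f∈ = ∈m^-+ (sumTo-∈m^ n (∀<suc⇒∀< f∈)) (f∈ n (ℕₚ.n<1+n n))

  sumTo-zero : ∀ {f} n → (∀ i → i < n → f i ≈ 0#) → sumTo R f n ≈ 0#
  sumTo-zero zero    f≈0 = refl
  sumTo-zero (suc n) f≈0 =
    trans (+-cong (sumTo-zero n (∀<suc⇒∀< f≈0)) (f≈0 n (ℕₚ.n<1+n n))) (+-identityˡ 0#)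

  sumTo-+ : ∀ f g n → sumTo R (λ i → f i + g i) n ≈ sumTo R f n + sumTo R g n
  sumTo-+ f g zero    = sym (+-identityˡ 0#)
  sumTo-+ f g (suc n) = trans (+-congʳ (sumTo-+ f g n)) (interchange _ _ _ _)

  sumTo-swap : ∀ (a : ℕ → ℕ → Carrier) m n →
               sumTo R (λ i → sumTo R (a i) m) n ≈ sumTo R (λ j → sumTo R (λ i → a i j) n) m
  sumTo-swap a m zero    = sym (sumTo-zero m (λ _ _ → refl))
  sumTo-swap a m (suc n) = trans (+-congʳ (sumTo-swap a m n)) (sym (sumTo-+ _ _ m))

  sumTo-suc : ∀ f n → sumTo R f (suc n) ≈ f 0 + sumTo R (λ i → f (suc i)) n
  sumTo-suc f zero    = +-comm 0# (f 0)
  sumTo-suc f (suc n) = trans (+-congʳ (sumTo-suc f n)) (+-assoc _ _ _)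

  ConvergesTo-resp : ∀ {s t L L′} → ConvergesTo R s L → (∀ n → s n ≈ t n) → L ≈ L′ → ConvergesTo R t L′
  ConvergesTo-resp s→L s≈t L≈L′ k = proj₁ (s→L k) , λ n N≤n →
    ~-resp (proj₂ (s→L k) n N≤n) (s≈t n) L≈L′

  ConvergesTo-+ : ∀ {s t L M} → ConvergesTo R s L → ConvergesTo R t M → ConvergesTo R (λ n → s n + t n) (L + M)
  ConvergesTo-+ s→L t→M k = proj₁ (s→L k) ⊔ℕ proj₁ (t→M k) , λ n N≤n →
    ~-+ (proj₂ (s→L k) n (ℕₚ.m⊔n≤o⇒m≤o _ _ N≤n)) (proj₂ (t→M k) n (ℕₚ.m⊔n≤o⇒n≤o _ _ N≤n))

  SeriesSum-resp : ∀ {a b L L′} → SeriesSum R a L → (∀ i → a i ≈ b i) → L ≈ L′ → SeriesSum R b L′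
  SeriesSum-resp ΣaL a≈b = ConvergesTo-resp ΣaL (λ n → sumTo-cong n (λ i _ → a≈b i))

  SeriesSum-+ : ∀ {a b L M} → SeriesSum R a L → SeriesSum R b M → SeriesSum R (λ i → a i + b i) (L + M)
  SeriesSum-+ {a} {b} ΣaL ΣbM = ConvergesTo-resp (ConvergesTo-+ ΣaL ΣbM) (λ n → sym (sumTo-+ a b n)) refl

  record IsFilteredAdditive (φ : Carrier → Carrier) : Set (c ⊔ ℓ) where
    field
      cong      : ∀ {x y} → x ≈ y → φ x ≈ φ y
      +-homo    : ∀ x y → φ (x + y) ≈ φ x + φ y
      ∈m^-homo  : ∀ {k x} → x ∈m^ k → φ x ∈m^ k

    0#-homo : φ 0# ≈ 0#
    0#-homo = x+x≈x⇒x≈0 _ (trans (sym (+-homo 0# 0#)) (cong (+-identityˡ 0#)))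

    -‿homo : ∀ x → φ (- x) ≈ - φ x
    -‿homo x = inverseʳ-unique (φ x) (φ (- x)) (trans (sym (+-homo x (- x))) (trans (cong (-‿inverseʳ x)) 0#-homo))

    difference-homo : ∀ x y → φ (x - y) ≈ φ x - φ y
    difference-homo x y = trans (+-homo x (- y)) (+-congˡ (-‿homo y))

    ~-homo : ∀ {k x y} → x ~[ k ] y → φ x ~[ k ] φ y
    ~-homo {x = x} {y} x~y = ∈m^-resp (∈m^-homo x~y) (difference-homo x y)

    sumTo-homo : ∀ f n → sumTo R (λ i → φ (f i)) n ≈ φ (sumTo R f n)
    sumTo-homo f zero    = sym 0#-homo
    sumTo-homo f (suc n) = trans (+-congʳ (sumTo-homo f n)) (sym (+-homo _ _))

    SeriesSum-homo : ∀ {a L} → SeriesSum R a L → SeriesSum R (λ i → φ (a i)) (φ L)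
    SeriesSum-homo ΣaL k = proj₁ (ΣaL k) , λ n N≤n →
      ~-resp (~-homo (proj₂ (ΣaL k) n N≤n)) (sym (sumTo-homo _ n)) refl

  *ˡ-filtered : ∀ r → IsFilteredAdditive (r *_)
  *ˡ-filtered r = record { cong = *-congˡ ; +-homo = distribˡ r ; ∈m^-homo = ∈m^-*ˡ r }

  *ʳ-filtered : ∀ r → IsFilteredAdditive (_* r)
  *ʳ-filtered r = record { cong = *-congʳ ; +-homo = λ x y → distribʳ r x y ; ∈m^-homo = ∈m^-*ʳ r }

  -‿filtered : IsFilteredAdditive (-_)
  -‿filtered = record { cong = -‿cong ; +-homo = λ x y → sym (⁻¹-∙-comm x y) ; ∈m^-homo = ∈m^-neg }

  ~-neg : ∀ {k x y} → x ~[ k ] y → - x ~[ k ] - y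
  ~-neg = IsFilteredAdditive.~-homo -‿filtered

  SeriesSum-*ˡ : ∀ r {a L} → SeriesSum R a L → SeriesSum R (λ i → r * a i) (r * L)
  SeriesSum-*ˡ r = IsFilteredAdditive.SeriesSum-homo (*ˡ-filtered r)

  SeriesSum-*ʳ : ∀ r {a L} → SeriesSum R a L → SeriesSum R (λ i → a i * r) (L * r)
  SeriesSum-*ʳ r = IsFilteredAdditive.SeriesSum-homo (*ʳ-filtered r)

  SeriesSum-- : ∀ {a b L M} → SeriesSum R a L → SeriesSum R b M → SeriesSum R (λ i → a i - b i) (L - M)
  SeriesSum-- ΣaL ΣbM = SeriesSum-+ ΣaL (IsFilteredAdditive.SeriesSum-homo -‿filtered ΣbM)

  TendsToZero : (ℕ → Carrier) → Set (c ⊔ ℓ)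
  TendsToZero a = ∀ K → Σ ℕ λ N → ∀ i → N ≤ i → a i ∈m^ K

  sumTo-stable : ∀ {K a m n} → (∀ i → m ≤ i → a i ∈m^ K) → m ≤ n → sumTo R a n ~[ K ] sumTo R a m
  sumTo-stable {K} {a} {m} small m≤n = go (ℕₚ.≤⇒≤′ m≤n)
    where
    go : ∀ {n} → m ≤′ n → sumTo R a n ~[ K ] sumTo R a m
    go ≤′-refl                = ~-refl
    go (≤′-step {n} m≤′n) =
      ~-resp (~-+ (go m≤′n) (∈m^⇒~0 (small n (ℕₚ.≤′⇒≤ m≤′n)))) refl (+-identityʳ _)

  SeriesSum-partial : ∀ {a L K} m → SeriesSum R a L → (∀ i → m ≤ i → a i ∈m^ K) → sumTo R a m ~[ K ] L
  SeriesSum-partial {K = K} m ΣaL small =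
    ~-trans (~-sym (sumTo-stable small (ℕₚ.m≤m⊔n m (proj₁ (ΣaL K)))))
            (proj₂ (ΣaL K) _ (ℕₚ.m≤n⊔m m (proj₁ (ΣaL K))))

  SeriesSum-∈m^ : ∀ {a L K} → SeriesSum R a L → (∀ i → a i ∈m^ K) → L ∈m^ K
  SeriesSum-∈m^ ΣaL a∈ = ~0⇒∈m^ (~-sym (SeriesSum-partial 0 ΣaL (λ i _ → a∈ i)))

  SeriesSum-drop : ∀ {a L} → SeriesSum R a L → SeriesSum R (λ i → a (suc i)) (L - a 0)
  SeriesSum-drop {a} ΣaL k = proj₁ (ΣaL k) , λ n N≤n →
    ~-resp (~-+ (proj₂ (ΣaL k) (suc n) (ℕₚ.m≤n⇒m≤1+n N≤n)) (~-refl {x = - a 0}))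
      (trans (+-congʳ (trans (sumTo-suc a n) (+-comm _ _))) (//-rightDividesʳ (a 0) _)) refl

  SeriesSum-cons : ∀ {a M} → SeriesSum R (λ i → a (suc i)) M → SeriesSum R a (a 0 + M)
  SeriesSum-cons {a} ΣM k = suc (proj₁ (ΣM k)) , λ where
    (suc n) (s≤s N≤n) → ~-resp (~-+ (~-refl {x = a 0}) (proj₂ (ΣM k) n N≤n)) (sym (sumTo-suc a n)) refl

  SeriesSum-finite : ∀ {a} N → (∀ i → N ≤ i → a i ≈ 0#) → SeriesSum R a (sumTo R a N)
  SeriesSum-finite N a≈0 k = N , λ n N≤n → sumTo-stable (λ i N≤i → ≈0⇒∈m^ k (a≈0 i N≤i)) N≤n

  SeriesSum-interchange : ∀ (a : ℕ → ℕ → Carrier) {row : ℕ → Carrier} {col : ℕ → Carrier} {W} →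
    (∀ K → Σ ℕ λ N → ∀ i k → N ≤ i ⊎ N ≤ k → a i k ∈m^ K) →
    (∀ k → SeriesSum R (λ i → a i k) (row k)) → SeriesSum R row W →
    (∀ i → SeriesSum R (a i) (col i)) → SeriesSum R col W
  SeriesSum-interchange a {row} {col} {W} small rows total cols K with small K
  ... | N , a∈ = N , partial
    where
    partial : ∀ m → N ≤ m → sumTo R col m ~[ K ] W
    partial m N≤m = ~-trans byColumns (~-trans (≈⇒~ (sumTo-swap a m m)) (~-trans byRows rowTail))
      where
      byColumns : sumTo R col m ~[ K ] sumTo R (λ i → sumTo R (a i) m) m
      byColumns = sumTo-~ m λ i _ →
        ~-sym (SeriesSum-partial m (cols i) (λ k m≤k → a∈ i k (inj₂ (ℕₚ.≤-trans N≤m m≤k))))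
      byRows : sumTo R (λ k → sumTo R (λ i → a i k) m) m ~[ K ] sumTo R row m
      byRows = sumTo-~ m λ k _ →
        SeriesSum-partial m (rows k) (λ i m≤i → a∈ i k (inj₁ (ℕₚ.≤-trans N≤m m≤i)))
      rowTail : sumTo R row m ~[ K ] W
      rowTail = SeriesSum-partial m total λ k m≤k →
        SeriesSum-∈m^ (rows k) (λ i → a∈ i k (inj₂ (ℕₚ.≤-trans N≤m m≤k)))

  module Limits (complete : Complete R) (separated : Separated R) where

    ~⇒≈ : ∀ {x y} → (∀ k → x ~[ k ] y) → x ≈ y
    ~⇒≈ {x} {y} x~y = x∙y⁻¹≈ε⇒x≈y x y (separated _ x~y)

    ConvergesTo-unique : ∀ {s L L′} → ConvergesTo R s L → ConvergesTo R s L′ → L ≈ L′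
    ConvergesTo-unique s→L s→L′ = ~⇒≈ λ k →
      ~-trans (~-sym (proj₂ (s→L k) _ (ℕₚ.m≤m⊔n (proj₁ (s→L k)) (proj₁ (s→L′ k)))))
              (proj₂ (s→L′ k) _ (ℕₚ.m≤n⊔m (proj₁ (s→L k)) (proj₁ (s→L′ k))))

    seriesSum : ∀ {a} → TendsToZero a → Σ Carrier (SeriesSum R a)
    seriesSum {a} a→0 = complete (sumTo R a) λ K → proj₁ (a→0 K) , λ n n′ N≤n N≤n′ →
      ~-trans (sumTo-stable (proj₂ (a→0 K)) N≤n) (~-sym (sumTo-stable (proj₂ (a→0 K)) N≤n′))

    Contraction : (Carrier → Carrier) → Set (c ⊔ ℓ)
    Contraction F = ∀ {k x y} → x ~[ k ] y → F x ~[ suc k ] F y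

    contraction-fixedPoint : ∀ {F} → Contraction F → Σ Carrier λ x → F x ≈ x
    contraction-fixedPoint {F} contract = x , ~⇒≈ Fx~x
      where
      iterate : ℕ → Carrier
      iterate zero    = 0#
      iterate (suc n) = F (iterate n)

      step : ∀ n → iterate (suc n) ~[ n ] iterate n
      step zero    = pow-zero _
      step (suc n) = contract (step n)

      stable : ∀ {K n} → K ≤′ n → iterate n ~[ K ] iterate K
      stable ≤′-refl                = ~-refl
      stable (≤′-step {n} K≤′n) = ~-trans (∈m^-antitone′ K≤′n (step n)) (stable K≤′n)

      limit : Σ Carrier (ConvergesTo R iterate)
      limit = complete iterate λ K → K , λ n n′ K≤n K≤n′ →
        ~-trans (stable (ℕₚ.≤⇒≤′ K≤n)) (~-sym (stable (ℕₚ.≤⇒≤′ K≤n′)))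

      x : Carrier
      x = proj₁ limit

      Fx~x : ∀ K → F x ~[ K ] x
      Fx~x K = ~-trans (∈m^-pred (contract (~-sym (proj₂ (proj₂ limit K) N ℕₚ.≤-refl))))
                       (proj₂ (proj₂ limit K) (suc N) (ℕₚ.n≤1+n N))
        where N = proj₁ (proj₂ limit K)

    -- Locality alone only gives ¬ ¬ Unit R w; the one-sided inverses are the geometric series
    -- Σ tⁿ, obtained as fixed points of x ↦ 1 + t x and y ↦ 1 + y t.
    1+m⊆Unit : ∀ {w t} → t ∈m^ 1 → w + t ≈ 1# → Unit R w
    1+m⊆Unit {w} {t} t∈m w+t≈1 = Unit-intro w*x≈1 y*w≈1
      where
      w≈1-t : w ≈ 1# - t
      w≈1-t = trans (sym (//-rightDividesʳ t w)) (+-congʳ w+t≈1)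

      right : Σ Carrier λ x → 1# + t * x ≈ x
      right = contraction-fixedPoint (λ x~y → ~-+ ~-refl (~-*ˡ-∈m^ t∈m x~y))
      left : Σ Carrier λ y → 1# + y * t ≈ y
      left = contraction-fixedPoint (λ x~y → ~-+ ~-refl (~-*ʳ-∈m^ t∈m x~y))
      x y : Carrier
      x = proj₁ right
      y = proj₁ left

      w*x≈1 : w * x ≈ 1#
      w*x≈1 = begin
        w * x                 ≈⟨ *-congʳ w≈1-t ⟩
        (1# - t) * x          ≈⟨ [y-z]x≈yx-zx x 1# t ⟩
        1# * x - t * x        ≈⟨ +-congʳ (trans (*-identityˡ x) (sym (proj₂ right))) ⟩
        (1# + t * x) - t * x  ≈⟨ //-rightDividesʳ (t * x) 1# ⟩
        1#                    ∎

      y*w≈1 : y * w ≈ 1#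
      y*w≈1 = begin
        y * w                 ≈⟨ *-congˡ w≈1-t ⟩
        y * (1# - t)          ≈⟨ x[y-z]≈xy-xz y 1# t ⟩
        y * 1# - y * t        ≈⟨ +-congʳ (trans (*-identityʳ y) (sym (proj₂ left))) ⟩
        (1# + y * t) - y * t  ≈⟨ //-rightDividesʳ (y * t) 1# ⟩
        1#                    ∎

m∸n≤1+m∸[1+n] : ∀ m n → m ∸ n ≤ suc (m ∸ suc n)
m∸n≤1+m∸[1+n] zero    zero    = z≤n
m∸n≤1+m∸[1+n] zero    (suc n) = z≤n
m∸n≤1+m∸[1+n] (suc m) zero    = ℕₚ.≤-refl
m∸n≤1+m∸[1+n] (suc m) (suc n) = m∸n≤1+m∸[1+n] m n

∸-triangle : ∀ m n o → m ∸ o ≤ (m ∸ n) +ℕ (n ∸ o)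
∸-triangle m       zero    zero    = ℕₚ.m≤m+n m 0
∸-triangle zero    n       zero    = z≤n
∸-triangle zero    n       (suc o) = z≤n
∸-triangle (suc m) (suc n) zero    =
  ℕₚ.≤-trans (ℕₚ.m≤n+m∸n (suc m) (suc n)) (ℕₚ.≤-reflexive (ℕₚ.+-comm (suc n) (m ∸ n)))
∸-triangle (suc m) zero    (suc o) =
  ℕₚ.≤-trans (ℕₚ.m∸n≤m m o) (ℕₚ.≤-trans (ℕₚ.n≤1+n m) (ℕₚ.m≤m+n (suc m) 0))
∸-triangle (suc m) (suc n) (suc o) = ∸-triangle m n o

module SkewPowerSeries {c ℓ} (R : Ring c ℓ) (local : IsLocal R)
  (σ δ : Ring.Carrier R → Ring.Carrier R)
  (σ-hom : IsRingHomomorphism (Ring.rawRing R) (Ring.rawRing R) σ)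
  (σ-nonUnit : ∀ x → NonUnit R x → NonUnit R (σ x))
  (δ-deriv : IsSigmaDerivation R σ δ)
  (δ-nonUnit : ∀ x → NonUnit R (δ x))
  (δ-m⊆m² : ∀ x → NonUnit R x → InPow R 2 (δ x))
  where

  open Ring R hiding (zero)
  open import Algebra.Properties.RingWithoutOne ringWithoutOne using (x+x≈x⇒x≈0)
  open import Algebra.Properties.Group +-group using (//-rightDividesˡ; //-rightDividesʳ)
  open import Algebra.Properties.CommutativeSemigroup +-commutativeSemigroup using (interchange)
  open import Relation.Binary.Reasoning.Setoid setoid
  open RingUnits R
  open LocalRingFiltration R local
  open IsLocalRel local using (zero-mem; add-mem; left-mem; right-mem)
  open IsRingHomomorphism σ-hom using ()
    renaming (⟦⟧-cong to σ-cong; +-homo to σ-+; *-homo to σ-*; 0#-homo to σ-0; 1#-homo to σ-1)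
  open IsSigmaDerivation δ-deriv using (leibniz) renaming (cong to δ-cong; +-homo to δ-+)
  open Skew R σ δ

  δ-0 : δ 0# ≈ 0#
  δ-0 = x+x≈x⇒x≈0 _ (trans (sym (δ-+ 0# 0#)) (δ-cong (+-identityˡ 0#)))

  δ-1 : δ 1# ≈ 0#
  δ-1 = x+x≈x⇒x≈0 _ (sym (begin
    δ 1#                      ≈⟨ δ-cong (*-identityˡ 1#) ⟨
    δ (1# * 1#)               ≈⟨ leibniz 1# 1# ⟩
    δ 1# * 1# + σ 1# * δ 1#   ≈⟨ +-cong (*-identityʳ _) (trans (*-congʳ σ-1) (*-identityˡ _)) ⟩
    δ 1# + δ 1#               ∎))

  σ-∈m^ : ∀ {k x} → x ∈m^ k → σ x ∈m^ k
  σ-∈m^ (pow-zero x)   = pow-zero _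
  σ-∈m^ (pow-0# x≈0)   = pow-0# (trans (σ-cong x≈0) σ-0)
  σ-∈m^ (pow-mul {a = a} {b = b} a∉U b∈ x≈ab) =
    pow-mul (σ-nonUnit a a∉U) (σ-∈m^ b∈) (trans (σ-cong x≈ab) (σ-* a b))
  σ-∈m^ (pow-add x₁∈ x₂∈ x≈) = pow-add (σ-∈m^ x₁∈) (σ-∈m^ x₂∈) (trans (σ-cong x≈) (σ-+ _ _))

  δ-raises-∈m^ : ∀ {k x} → x ∈m^ k → δ x ∈m^ suc k
  δ-raises-∈m^ (pow-zero x)   = NonUnit⇒∈m¹ (δ-nonUnit x)
  δ-raises-∈m^ (pow-0# x≈0)   = pow-0# (trans (δ-cong x≈0) δ-0)
  δ-raises-∈m^ (pow-mul {a = a} {b = b} a∉U b∈ x≈ab) =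
    ∈m^-resp (∈m^-+ (∈m^-* (δ-m⊆m² a a∉U) b∈) (pow-mul (σ-nonUnit a a∉U) (δ-raises-∈m^ b∈) refl))
             (sym (trans (δ-cong x≈ab) (leibniz a b)))
  δ-raises-∈m^ (pow-add x₁∈ x₂∈ x≈) =
    ∈m^-resp (∈m^-+ (δ-raises-∈m^ x₁∈) (δ-raises-∈m^ x₂∈)) (sym (trans (δ-cong x≈) (δ-+ _ _)))

  σ-filtered : IsFilteredAdditive σ
  σ-filtered = record { cong = σ-cong ; +-homo = σ-+ ; ∈m^-homo = σ-∈m^ }

  δ-filtered : IsFilteredAdditive δ
  δ-filtered = record { cong = δ-cong ; +-homo = δ-+ ; ∈m^-homo = λ x∈ → ∈m^-pred (δ-raises-∈m^ x∈) }

  module σF = IsFilteredAdditive σ-filtered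
  module δF = IsFilteredAdditive δ-filtered

  τ-cong : ∀ i k {x y} → x ≈ y → τ i k x ≈ τ i k y
  τ-cong zero    zero    x≈y = x≈y
  τ-cong zero    (suc k) x≈y = refl
  τ-cong (suc i) zero    x≈y = δ-cong (τ-cong i zero x≈y)
  τ-cong (suc i) (suc k) x≈y = +-cong (σ-cong (τ-cong i k x≈y)) (δ-cong (τ-cong i (suc k) x≈y))

  τ-+ : ∀ i k x y → τ i k (x + y) ≈ τ i k x + τ i k y
  τ-+ zero    zero    x y = refl
  τ-+ zero    (suc k) x y = sym (+-identityˡ 0#)
  τ-+ (suc i) zero    x y = trans (δ-cong (τ-+ i zero x y)) (δ-+ _ _)
  τ-+ (suc i) (suc k) x y =
    trans (+-cong (trans (σ-cong (τ-+ i k x y)) (σ-+ _ _)) (trans (δ-cong (τ-+ i (suc k) x y)) (δ-+ _ _)))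
          (interchange _ _ _ _)

  τ-∈m^ : ∀ i j {k x} → x ∈m^ k → τ i j x ∈m^ k
  τ-∈m^ zero    zero    x∈ = x∈
  τ-∈m^ zero    (suc j) x∈ = ≈0⇒∈m^ _ refl
  τ-∈m^ (suc i) zero    x∈ = ∈m^-pred (δ-raises-∈m^ (τ-∈m^ i zero x∈))
  τ-∈m^ (suc i) (suc j) x∈ = ∈m^-+ (σ-∈m^ (τ-∈m^ i j x∈)) (∈m^-pred (δ-raises-∈m^ (τ-∈m^ i (suc j) x∈)))

  τ-filtered : ∀ i k → IsFilteredAdditive (τ i k)
  τ-filtered i k = record { cong = τ-cong i k ; +-homo = τ-+ i k ; ∈m^-homo = τ-∈m^ i k }

  τ-order : ∀ i k x → τ i k x ∈m^ (i ∸ k)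
  τ-order zero    zero    x = pow-zero x
  τ-order zero    (suc k) x = ≈0⇒∈m^ _ refl
  τ-order (suc i) zero    x = δ-raises-∈m^ (τ-order i zero x)
  τ-order (suc i) (suc k) x =
    ∈m^-+ (σ-∈m^ (τ-order i k x)) (∈m^-antitone (m∸n≤1+m∸[1+n] i k) (δ-raises-∈m^ (τ-order i (suc k) x)))

  τ-1-diagonal    : ∀ i → τ i i 1# ≈ 1#
  τ-1-offDiagonal : ∀ i k → ¬ (i ≡ k) → τ i k 1# ≈ 0#
  δ-τ-1           : ∀ i k → δ (τ i k 1#) ≈ 0#

  τ-1-diagonal zero    = refl
  τ-1-diagonal (suc i) = trans (+-cong (trans (σ-cong (τ-1-diagonal i)) σ-1) (δ-τ-1 i (suc i))) (+-identityʳ 1#)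

  τ-1-offDiagonal zero    zero    i≢k = ⊥-elim (i≢k ≡.refl)
  τ-1-offDiagonal zero    (suc k) i≢k = refl
  τ-1-offDiagonal (suc i) zero    i≢k = δ-τ-1 i zero
  τ-1-offDiagonal (suc i) (suc k) i≢k =
    trans (+-cong (trans (σ-cong (τ-1-offDiagonal i k (λ i≡k → i≢k (≡.cong suc i≡k)))) σ-0) (δ-τ-1 i (suc k)))
          (+-identityˡ 0#)

  δ-τ-1 i k with i ℕ.≟ k
  ... | yes ≡.refl = trans (δ-cong (τ-1-diagonal i)) δ-1
  ... | no  i≢k    = trans (δ-cong (τ-1-offDiagonal i k i≢k)) δ-0

  -- The coefficient of Xⁿ in Xⁱ g; by definition productTerm f g n i = f i * (X^ i · g) n.
  X^_·_ : ℕ → Series R → Series R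
  (X^ i · g) n = sumTo R (λ j → τ i (n ∸ j) (g j)) (suc n)

  X·_ : Series R → Series R
  (X· s) zero    = δ (s zero)
  (X· s) (suc n) = σ (s n) + δ (s (suc n))

  X^·-cong : ∀ {g g′} → (∀ j → g j ≈ g′ j) → ∀ i n → (X^ i · g) n ≈ (X^ i · g′) n
  X^·-cong g≈g′ i n = sumTo-cong (suc n) (λ j _ → τ-cong i (n ∸ j) (g≈g′ j))

  X^·-order : ∀ g i n → (X^ i · g) n ∈m^ (i ∸ n)
  X^·-order g i n = sumTo-∈m^ (suc n) λ j _ →
    ∈m^-antitone (ℕₚ.∸-monoʳ-≤ i (ℕₚ.m∸n≤m n j)) (τ-order i (n ∸ j) (g j))

  τ-at-n∸n : ∀ i n x → τ i (n ∸ n) x ≈ τ i 0 x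
  τ-at-n∸n i n x rewrite ℕₚ.n∸n≡0 n = refl

  X^0· : ∀ g n → (X^ 0 · g) n ≈ g n
  X^0· g n = trans (+-cong (sumTo-zero n below) (τ-at-n∸n 0 n (g n))) (+-identityˡ _)
    where
    below : ∀ j → j < n → τ 0 (n ∸ j) (g j) ≈ 0#
    below j j<n with n ∸ j | ℕₚ.m<n⇒0<n∸m j<n
    ... | suc _ | _ = refl

  X^·1 : ∀ i n → (X^ i · oneA) n ≈ τ i n 1#
  X^·1 i n = trans (sumTo-suc (λ j → τ i (n ∸ j) (oneA j)) n)
    (trans (+-congˡ (sumTo-zero n (λ j _ → IsFilteredAdditive.0#-homo (τ-filtered i (n ∸ suc j))))) (+-identityʳ _))

  X^suc· : ∀ g i n → (X^ suc i · g) n ≈ (X· (X^ i · g)) n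
  X^suc· g i zero    = trans (+-identityˡ _) (δ-cong (sym (+-identityˡ _)))
  X^suc· g i (suc n) = begin
    sumTo R (λ j → τ (suc i) (suc n ∸ j) (g j)) (suc n) + τ (suc i) (n ∸ n) (g (suc n))
      ≈⟨ +-cong (sumTo-cong (suc n) λ j j<1+n → unfoldτ j (g j) (ℕₚ.≤-pred j<1+n))
                (unfoldτ-last (g (suc n))) ⟩
    sumTo R (λ j → σ (τ i (n ∸ j) (g j)) + δ (τ i (suc n ∸ j) (g j))) (suc n) + δ (τ i (n ∸ n) (g (suc n)))
      ≈⟨ +-congʳ (sumTo-+ _ _ (suc n)) ⟩
    (sumTo R (λ j → σ (τ i (n ∸ j) (g j))) (suc n) + sumTo R (λ j → δ (τ i (suc n ∸ j) (g j))) (suc n))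
      + δ (τ i (n ∸ n) (g (suc n)))
      ≈⟨ +-assoc _ _ _ ⟩
    sumTo R (λ j → σ (τ i (n ∸ j) (g j))) (suc n)
      + (sumTo R (λ j → δ (τ i (suc n ∸ j) (g j))) (suc n) + δ (τ i (n ∸ n) (g (suc n))))
      ≈⟨ +-cong (σF.sumTo-homo _ (suc n)) (δF.sumTo-homo _ (suc (suc n))) ⟩
    σ ((X^ i · g) n) + δ ((X^ i · g) (suc n))
      ∎
    where
    unfoldτ : ∀ j x → j ≤ n → τ (suc i) (suc n ∸ j) x ≈ σ (τ i (n ∸ j) x) + δ (τ i (suc n ∸ j) x)
    unfoldτ j x j≤n rewrite ℕₚ.+-∸-assoc 1 j≤n = refl
    unfoldτ-last : ∀ x → τ (suc i) (n ∸ n) x ≈ δ (τ i (n ∸ n) x)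
    unfoldτ-last x rewrite ℕₚ.n∸n≡0 n = refl

  X·-*ˡ : ∀ a s n → (X· (λ m → a * s m)) n ≈ σ a * (X· s) n + δ a * s n
  X·-*ˡ a s zero    = trans (leibniz a (s 0)) (+-comm _ _)
  X·-*ˡ a s (suc n) = begin
    σ (a * s n) + δ (a * s (suc n))                          ≈⟨ +-cong (σ-* a (s n)) (leibniz a (s (suc n))) ⟩
    σ a * σ (s n) + (δ a * s (suc n) + σ a * δ (s (suc n)))  ≈⟨ +-congˡ (+-comm _ _) ⟩
    σ a * σ (s n) + (σ a * δ (s (suc n)) + δ a * s (suc n))  ≈⟨ +-assoc _ _ _ ⟨
    (σ a * σ (s n) + σ a * δ (s (suc n))) + δ a * s (suc n)  ≈⟨ +-congʳ (distribˡ (σ a) _ _) ⟨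
    σ a * (σ (s n) + δ (s (suc n))) + δ a * s (suc n)        ∎

  X·-SeriesSum : ∀ {s : ℕ → Series R} {v : Series R} →
                 (∀ n → SeriesSum R (λ k → s k n) (v n)) → ∀ n → SeriesSum R (λ k → (X· s k) n) ((X· v) n)
  X·-SeriesSum Σs zero    = δF.SeriesSum-homo (Σs 0)
  X·-SeriesSum Σs (suc n) = SeriesSum-+ (σF.SeriesSum-homo (Σs n)) (δF.SeriesSum-homo (Σs (suc n)))

  IsProduct-cong : ∀ {f g h f′ g′ h′} → IsProduct f g h →
                   (∀ i → f i ≈ f′ i) → (∀ j → g j ≈ g′ j) → (∀ n → h n ≈ h′ n) → IsProduct f′ g′ h′
  IsProduct-cong fg≈h f≈f′ g≈g′ h≈h′ n =
    SeriesSum-resp (fg≈h n) (λ i → *-cong (f≈f′ i) (X^·-cong g≈g′ i n)) (h≈h′ n)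

  productTerm-tendsToZero : ∀ f g n → TendsToZero (productTerm f g n)
  productTerm-tendsToZero f g n K = K +ℕ n , λ i K+n≤i →
    ∈m^-antitone (ℕₚ.m+n≤o⇒m≤o∸n K K+n≤i) (∈m^-*ˡ (f i) (X^·-order g i n))

  IsProduct-identityˡ : ∀ h → IsProduct oneA h h
  IsProduct-identityˡ h n = SeriesSum-resp (SeriesSum-finite 1 higher) (λ _ → refl)
    (trans (+-identityˡ _) (trans (*-identityˡ _) (X^0· h n)))
    where
    higher : ∀ i → 1 ≤ i → productTerm oneA h n i ≈ 0#
    higher (suc i) _ = zeroˡ _

  IsProduct-identityʳ : ∀ f → IsProduct f oneA f
  IsProduct-identityʳ f n = SeriesSum-resp (SeriesSum-finite (suc n) higher) (λ _ → refl) diagonal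
    where
    offDiagonal : ∀ i → ¬ (i ≡ n) → productTerm f oneA n i ≈ 0#
    offDiagonal i i≢n = trans (*-congˡ (trans (X^·1 i n) (τ-1-offDiagonal i n i≢n))) (zeroʳ _)
    higher : ∀ i → suc n ≤ i → productTerm f oneA n i ≈ 0#
    higher i n<i = offDiagonal i (λ i≡n → ℕₚ.<-irrefl (≡.sym i≡n) n<i)
    diagonal : sumTo R (productTerm f oneA n) (suc n) ≈ f n
    diagonal = trans (+-cong (sumTo-zero n (λ i i<n → offDiagonal i (λ i≡n → ℕₚ.<-irrefl i≡n i<n)))
                             (trans (*-congˡ (trans (X^·1 n n) (τ-1-diagonal n))) (*-identityʳ _)))
                     (+-identityˡ _)

  IsProduct-constantTerm : ∀ {f g h} → IsProduct f g h → Σ Carrier λ t → t ∈m^ 1 × h 0 ≈ f 0 * g 0 + t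
  IsProduct-constantTerm {f} {g} {h} fg≈h = t , SeriesSum-∈m^ (SeriesSum-drop (fg≈h 0)) higher∈m , h₀≈
    where
    t : Carrier
    t = h 0 - f 0 * (X^ 0 · g) 0
    higher∈m : ∀ i → productTerm f g 0 (suc i) ∈m^ 1
    higher∈m i = ∈m^-*ˡ (f (suc i)) (∈m^-antitone (s≤s z≤n) (X^·-order g (suc i) 0))
    h₀≈ : h 0 ≈ f 0 * g 0 + t
    h₀≈ = trans (sym (trans (+-comm _ _) (//-rightDividesˡ (f 0 * (X^ 0 · g) 0) (h 0))))
                (+-congʳ (*-congˡ (X^0· g 0)))

  module Units (complete : Complete R) (separated : Separated R) where
    open Limits complete separated

    -- Xᵏ⁺¹ h = X (Xᵏ h) and X a = σ(a) X + δ(a) turn the series for (X g) h into the one for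
    -- X (g h), except that its δ-part is shifted by one index.
    IsProduct-X·ˡ : ∀ {g h v} → IsProduct g h v → IsProduct (X· g) h (X· v)
    IsProduct-X·ˡ {g} {h} {v} gh≈v n = SeriesSum-resp (SeriesSum-cons ΣA+B′) (λ _ → refl) cancel
      where
      A B : ℕ → Carrier
      A k = σ (g k) * (X^ suc k · h) n
      B k = δ (g k) * (X^ k · h) n

      ΣA+B : SeriesSum R (λ k → A k + B k) ((X· v) n)
      ΣA+B = SeriesSum-resp (X·-SeriesSum gh≈v n)
        (λ k → trans (X·-*ˡ (g k) (X^ k · h) n) (+-congʳ (*-congˡ (sym (X^suc· h k n))))) refl

      ΣB : Σ Carrier (SeriesSum R B)
      ΣB = seriesSum (productTerm-tendsToZero (λ k → δ (g k)) h n)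
      LB : Carrier
      LB = proj₁ ΣB

      ΣA : SeriesSum R A ((X· v) n - LB)
      ΣA = SeriesSum-resp (SeriesSum-- ΣA+B (proj₂ ΣB)) (λ k → //-rightDividesʳ (B k) (A k)) refl

      ΣA+B′ : SeriesSum R (λ k → productTerm (X· g) h n (suc k)) (((X· v) n - LB) + (LB - B 0))
      ΣA+B′ = SeriesSum-resp (SeriesSum-+ ΣA (SeriesSum-drop (proj₂ ΣB))) (λ k → sym (distribʳ _ _ _)) refl

      cancel : B 0 + (((X· v) n - LB) + (LB - B 0)) ≈ (X· v) n
      cancel = trans (+-congˡ ([x-y]+[y-z]≈x-z _ LB _)) (trans (+-comm _ _) (//-rightDividesˡ (B 0) _))

    IsProduct-X^·ˡ : ∀ {g h v} → IsProduct g h v → ∀ i → IsProduct (X^ i · g) h (X^ i · v)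
    IsProduct-X^·ˡ {g} {h} {v} gh≈v zero =
      IsProduct-cong gh≈v (λ m → sym (X^0· g m)) (λ _ → refl) (λ m → sym (X^0· v m))
    IsProduct-X^·ˡ {g} {h} {v} gh≈v (suc i) =
      IsProduct-cong (IsProduct-X·ˡ (IsProduct-X^·ˡ gh≈v i))
        (λ m → sym (X^suc· g i m)) (λ _ → refl) (λ m → sym (X^suc· v i m))

    -- Both sides are the sum of the double series fᵢ (Xⁱ g)ₖ (Xᵏ h)ₙ, by rows and by columns.
    IsProduct-assoc : ∀ {f g h u v w w′} → IsProduct f g u → IsProduct g h v →
                      IsProduct u h w → IsProduct f v w′ → ∀ n → w n ≈ w′ n
    IsProduct-assoc {f} {g} {h} {u} {v} fg≈u gh≈v uh≈w fv≈w′ n =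
      ConvergesTo-unique (SeriesSum-interchange a small rows (uh≈w n) cols) (fv≈w′ n)
      where
      a : ℕ → ℕ → Carrier
      a i k = (f i * (X^ i · g) k) * (X^ k · h) n

      rows : ∀ k → SeriesSum R (λ i → a i k) (u k * (X^ k · h) n)
      rows k = SeriesSum-*ʳ ((X^ k · h) n) (fg≈u k)

      cols : ∀ i → SeriesSum R (a i) (f i * (X^ i · v) n)
      cols i = SeriesSum-resp (SeriesSum-*ˡ (f i) (IsProduct-X^·ˡ gh≈v i n)) (λ k → sym (*-assoc _ _ _)) refl

      small : ∀ K → Σ ℕ λ N → ∀ i k → N ≤ i ⊎ N ≤ k → a i k ∈m^ K
      small K = K +ℕ n , λ i k far →
        ∈m^-antitone (bound i k far) (∈m^-* (∈m^-*ˡ (f i) (X^·-order g i k)) (X^·-order h k n))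
        where
        bound : ∀ i k → K +ℕ n ≤ i ⊎ K +ℕ n ≤ k → K ≤ (i ∸ k) +ℕ (k ∸ n)
        bound i k (inj₁ K+n≤i) = ℕₚ.≤-trans (ℕₚ.m+n≤o⇒m≤o∸n K K+n≤i) (∸-triangle i k n)
        bound i k (inj₂ K+n≤k) = ℕₚ.≤-trans (ℕₚ.m+n≤o⇒m≤o∸n K K+n≤k) (ℕₚ.m≤n+m (k ∸ n) (i ∸ k))

    -- The n-th coefficient of f g is the sum of lowerSum, which depends on g₀ … gₙ₋₁ only,
    -- and f₀ gₙ + tail gₙ, where tail raises m-adic order.
    module RightInverse (f : Series R) (f₀-unit : Unit R (f 0)) where
      f₀⁻¹ : Carrier
      f₀⁻¹ = proj₁ f₀-unit

      lowerPart : Series R → ℕ → ℕ → Carrier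
      lowerPart p n i = sumTo R (λ j → τ i (n ∸ j) (p j)) n

      lowerPart-tendsToZero : ∀ p n → TendsToZero (λ i → f i * lowerPart p n i)
      lowerPart-tendsToZero p n K = K +ℕ n , λ i K+n≤i →
        ∈m^-antitone (ℕₚ.m+n≤o⇒m≤o∸n K K+n≤i) (∈m^-*ˡ (f i) (sumTo-∈m^ n λ j _ →
          ∈m^-antitone (ℕₚ.∸-monoʳ-≤ i (ℕₚ.m∸n≤m n j)) (τ-order i (n ∸ j) (p j))))

      lowerSum : Series R → ℕ → Carrier
      lowerSum p n = proj₁ (seriesSum (lowerPart-tendsToZero p n))

      tailTerm : Carrier → ℕ → Carrier
      tailTerm x i = f (suc i) * τ (suc i) 0 x

      tailTerm-tendsToZero : ∀ x → TendsToZero (tailTerm x)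
      tailTerm-tendsToZero x K = K , λ i K≤i →
        ∈m^-antitone (ℕₚ.m≤n⇒m≤1+n K≤i) (∈m^-*ˡ (f (suc i)) (τ-order (suc i) 0 x))

      tail : Carrier → Carrier
      tail x = proj₁ (seriesSum (tailTerm-tendsToZero x))

      tail-contraction : Contraction tail
      tail-contraction {k} {x} {y} x~y =
        SeriesSum-∈m^ (SeriesSum-- (proj₂ (seriesSum (tailTerm-tendsToZero x)))
                                   (proj₂ (seriesSum (tailTerm-tendsToZero y)))) term~
        where
        term~ : ∀ i → tailTerm x i ~[ suc k ] tailTerm y i
        term~ i = ~-*ˡ (f (suc i)) (∈m^-resp (δ-raises-∈m^ (τ-∈m^ i 0 x~y))
                                             (IsFilteredAdditive.difference-homo (τ-filtered (suc i) 0) x y))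

      diagonalSum : ∀ x → SeriesSum R (λ i → f i * τ i 0 x) (f 0 * x + tail x)
      diagonalSum x = SeriesSum-cons (proj₂ (seriesSum (tailTerm-tendsToZero x)))

      opaque
        solution : ∀ c → Σ Carrier λ x → f₀⁻¹ * (c - tail x) ≈ x
        solution c = contraction-fixedPoint λ x~y → ~-*ˡ f₀⁻¹ (~-+ (~-refl {x = c}) (~-neg (tail-contraction x~y)))

      solve : Carrier → Carrier
      solve c = proj₁ (solution c)

      solve-spec : ∀ c → f 0 * solve c + tail (solve c) ≈ c
      solve-spec c = begin
        f 0 * x + tail x                     ≈⟨ +-congʳ (*-congˡ (proj₂ (solution c))) ⟨
        f 0 * (f₀⁻¹ * (c - tail x)) + tail x ≈⟨ +-congʳ (*-assoc (f 0) f₀⁻¹ _) ⟨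
        (f 0 * f₀⁻¹) * (c - tail x) + tail x ≈⟨ +-congʳ (*-congʳ (proj₁ (proj₂ f₀-unit))) ⟩
        1# * (c - tail x) + tail x           ≈⟨ +-congʳ (*-identityˡ _) ⟩
        (c - tail x) + tail x                ≈⟨ //-rightDividesˡ (tail x) c ⟩
        c                                    ∎
        where
        x : Carrier
        x = solve c

      target : Series R → ℕ → Carrier
      target p n = oneA n - lowerSum p n

      extend : Series R → ℕ → Carrier → Series R
      extend p n x j with j ℕ.<? n
      ... | yes _ = p j
      ... | no  _ = x

      -- Course-of-values recursion: truncation n holds the coefficients g₀ … gₙ₋₁ of the inverse.
      truncation : ℕ → Series R
      truncation zero    = λ _ → 0#
      truncation (suc n) = extend (truncation n) n (solve (target (truncation n) n))

      inverse : Series R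
      inverse n = solve (target (truncation n) n)

      truncation-agrees : ∀ {m j} → j < m → truncation m j ≡ inverse j
      truncation-agrees {suc m} {j} j<1+m with j ℕ.<? m
      ... | yes j<m = truncation-agrees j<m
      ... | no  j≮m = ≡.cong inverse (≡.sym (ℕₚ.≤-antisym (ℕₚ.≤-pred j<1+m) (ℕₚ.≮⇒≥ j≮m)))

      isRightInverse : IsProduct f inverse oneA
      isRightInverse n = SeriesSum-resp (SeriesSum-+ lowerPartSum (diagonalSum (inverse n))) split total
        where
        lowerPartSum : SeriesSum R (λ i → f i * lowerPart inverse n i) (lowerSum (truncation n) n)
        lowerPartSum = SeriesSum-resp (proj₂ (seriesSum (lowerPart-tendsToZero (truncation n) n)))
          (λ i → *-congˡ (sumTo-cong n (λ j j<n → reflexive (≡.cong (τ i (n ∸ j)) (truncation-agrees j<n))))) refl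

        split : ∀ i → f i * lowerPart inverse n i + f i * τ i 0 (inverse n) ≈ productTerm f inverse n i
        split i = trans (sym (distribˡ (f i) _ _)) (*-congˡ (+-congˡ (sym (τ-at-n∸n i n (inverse n)))))

        total : lowerSum (truncation n) n + (f 0 * inverse n + tail (inverse n)) ≈ oneA n
        total = trans (+-congˡ (solve-spec (target (truncation n) n)))
                      (trans (+-comm _ _) (//-rightDividesˡ (lowerSum (truncation n) n) (oneA n)))

    rightInverse : ∀ f → Unit R (f 0) → Σ (Series R) λ g → IsProduct f g oneA
    rightInverse f f₀-unit = RightInverse.inverse f f₀-unit , RightInverse.isRightInverse f f₀-unit

    opaque
      IsProduct-oneA⇒Unit₀ : ∀ {f g} → IsProduct f g oneA → Unit R (f 0 * g 0)
      IsProduct-oneA⇒Unit₀ fg≈1 with IsProduct-constantTerm fg≈1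
      ... | t , t∈m , 1≈f₀g₀+t = 1+m⊆Unit t∈m (sym 1≈f₀g₀+t)

    Unit⇒UnitA : ∀ f → Unit R (f 0) → UnitA f
    Unit⇒UnitA f f₀-unit = g , fg≈1 , IsProduct-cong gh≈1 (λ _ → refl) h≈f (λ _ → refl)
      where
      g : Series R
      g = proj₁ (rightInverse f f₀-unit)
      fg≈1 : IsProduct f g oneA
      fg≈1 = proj₂ (rightInverse f f₀-unit)
      g₀-unit : Unit R (g 0)
      g₀-unit = Unit-*-cancelˡ f₀-unit (IsProduct-oneA⇒Unit₀ fg≈1)
      h : Series R
      h = proj₁ (rightInverse g g₀-unit)
      gh≈1 : IsProduct g h oneA
      gh≈1 = proj₂ (rightInverse g g₀-unit)
      h≈f : ∀ n → h n ≈ f n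
      h≈f = IsProduct-assoc fg≈1 gh≈1 (IsProduct-identityˡ h) (IsProduct-identityʳ f)

    UnitA⇒Unit : ∀ f → UnitA f → Unit R (f 0)
    UnitA⇒Unit f (g , fg≈1 , gf≈1) =
      Unit-intro (trans (sym (*-assoc (f 0) (g 0) a)) f₀g₀a≈1) (trans (*-assoc b (g 0) (f 0)) bg₀f₀≈1)
      where
      a b : Carrier
      a = proj₁ (IsProduct-oneA⇒Unit₀ fg≈1)
      b = proj₁ (IsProduct-oneA⇒Unit₀ gf≈1)
      f₀g₀a≈1 : (f 0 * g 0) * a ≈ 1#
      f₀g₀a≈1 = proj₁ (proj₂ (IsProduct-oneA⇒Unit₀ fg≈1))
      bg₀f₀≈1 : b * (g 0 * f 0) ≈ 1#
      bg₀f₀≈1 = proj₂ (proj₂ (IsProduct-oneA⇒Unit₀ gf≈1))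

    ¬UnitA⇒NonUnit₀ : ∀ {f} → ¬ UnitA f → NonUnit R (f 0)
    ¬UnitA⇒NonUnit₀ {f} f∉U f₀∈U = f∉U (Unit⇒UnitA f f₀∈U)

    IsProduct-nonUnit₀ : ∀ {f g h} → IsProduct f g h → NonUnit R (f 0 * g 0) → NonUnit R (h 0)
    IsProduct-nonUnit₀ fg≈h f₀g₀∉U with IsProduct-constantTerm fg≈h
    ... | t , t∈m , h₀≈ = NonUnit-resp (add-mem _ t f₀g₀∉U (∈m¹⇒NonUnit t∈m)) (sym h₀≈)

    isLocalA : IsLocalA
    isLocalA = record
      { zero-mem  = λ 0∈U → zero-mem (UnitA⇒Unit zeroA 0∈U)
      ; add-mem   = λ f g f∉U g∉U f+g∈U →
          add-mem (f 0) (g 0) (¬UnitA⇒NonUnit₀ f∉U) (¬UnitA⇒NonUnit₀ g∉U) (UnitA⇒Unit (f +A g) f+g∈U)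
      ; left-mem  = λ s f h f∉U sf≈h h∈U →
          IsProduct-nonUnit₀ sf≈h (left-mem (s 0) (f 0) _ (¬UnitA⇒NonUnit₀ f∉U) refl) (UnitA⇒Unit h h∈U)
      ; right-mem = λ f s h f∉U fs≈h h∈U →
          IsProduct-nonUnit₀ fs≈h (right-mem (f 0) (s 0) _ (¬UnitA⇒NonUnit₀ f∉U) refl) (UnitA⇒Unit h h∈U)
      ; proper    = λ 1∉U → 1∉U (Unit⇒UnitA oneA (1# , *-identityˡ 1# , *-identityˡ 1#))
      }

proposition2p11 : ∀ {c ℓ : Level} (R : Ring c ℓ)
    → IsLocal R → Complete R → Separated R
    → (σ δ : Ring.Carrier R → Ring.Carrier R)
    → IsRingHomomorphism (Ring.rawRing R) (Ring.rawRing R) σ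
    → (∀ x → NonUnit R x → NonUnit R (σ x))
    → IsSigmaDerivation R σ δ
    → (∀ x → NonUnit R (δ x))
    → (∀ x → NonUnit R x → InPow R 2 (δ x))
    → ((f : Series R) → (Skew.UnitA R σ δ f ⇔ Unit R (f 0)))
    × Skew.IsLocalA R σ δ
proposition2p11 R local complete separated σ δ σ-hom σ-nonUnit δ-deriv δ-nonUnit δ-m⊆m² =
  (λ f → mk⇔ (UnitA⇒Unit f) (Unit⇒UnitA f)) , isLocalA
  where
  open SkewPowerSeries R local σ δ σ-hom σ-nonUnit δ-deriv δ-nonUnit δ-m⊆m²
  open Units complete separated
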